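{- Let $G$ be a strongly connected directed graph that is not a closed path, and let $e$ be a join-free arc of $G$. A walk $W'$ of $c_e(G)$ is an omnitig of $c_e(G)$ if and only if there exists an omnitig $W$ of $G$ such that $W'=c_e(W)$.
   Context: Graphs are finite directed multigraphs (parallel arcs and self-loops allowed); $t(e)$, $h(e)$ are tail and head of arc $e$. A walk is a sequence of arcs $e_1\dots e_\ell$ with $h(e_i)=t(e_{i+1})$; a path is a walk with distinct nodes except the last may equal the first. A closed path is a graph consisting of a single cycle. An arc $e$ is join-free if $h(e)$ has in-degree at most 1. $c_e(G)$ is the graph obtained from $G$ by contracting $e$ (removing $e$ and identifying its two endpoints); for a walk $W$ of $G$ (viewed as a sequence of arcs), $c_e(W)$ is the walk of $c_e(G)$ obtained by removing every occurrence of $e$. A walk $W=e_0\dots e_\ell$ is an omnitig if for all $1\le i\le j\le \ell$ there is no non-empty path from $t(e_j)$ to $h(e_{i-1})$ whose first arc differs from $e_j$ and whose last arc differs from $e_{i-1}$. -}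

module Defs where

open import Data.Nat using (ℕ; zero; suc; pred; _<_; _≤_)
open import Data.Fin using (Fin; toℕ; punchIn; punchOut; _≟_)
open import Data.List using (List; []; _∷_; map; length; lookup; head; last; filter; allFin)
open import Data.Maybe using (Maybe; just)
open import Data.Product using (Σ; ∃; _×_; _,_)
open import Data.Sum using (_⊎_)
open import Data.Unit using (⊤)
open import Relation.Nullary using (¬_; yes; no)
open import Relation.Binary.PropositionalEquality using (_≡_; _≢_; refl; sym)
open import Function using (_∘_)

record Graph : Set where
  field
    nV : ℕ
    nA : ℕ
    tl : Fin nA → Fin nV
    hd : Fin nA → Fin nV
open Graph public

Node : Graph → Set
Node G = Fin (nV G)

Arc : Graph → Set
Arc G = Fin (nA G)

module _ (G : Graph) where

  Consecutive : List (Arc G) → Set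
  Consecutive []           = ⊤
  Consecutive (a ∷ [])     = ⊤
  Consecutive (a ∷ b ∷ r)  = hd G a ≡ tl G b × Consecutive (b ∷ r)

  IsWalk : List (Arc G) → Set
  IsWalk W = (W ≢ []) × Consecutive W

  nodes : List (Arc G) → List (Node G)
  nodes []      = []
  nodes (a ∷ r) = tl G a ∷ map (hd G) (a ∷ r)

  -- walk whose nodes are distinct, except the last may equal the first
  IsPath : List (Arc G) → Set
  IsPath P = IsWalk P ×
    ((p q : Fin (length (nodes P))) → toℕ p < toℕ q →
       lookup (nodes P) p ≡ lookup (nodes P) q →
       (toℕ p ≡ 0 × toℕ q ≡ length P))

  StartsEnds : List (Arc G) → Node G → Node G → Set
  StartsEnds W u v = head (nodes W) ≡ just u × last (nodes W) ≡ just v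

  StronglyConnected : Set
  StronglyConnected = (u v : Node G) →
    u ≡ v ⊎ Σ (List (Arc G)) (λ W → IsWalk W × StartsEnds W u v)

  data _∈_ {A : Set} (x : A) : List A → Set where
    here  : ∀ {xs} → x ∈ (x ∷ xs)
    there : ∀ {y xs} → x ∈ xs → x ∈ (y ∷ xs)

  IsClosedPathGraph : Set
  IsClosedPathGraph = Σ (List (Arc G)) λ P →
    IsPath P × head (nodes P) ≡ last (nodes P) ×
    ((a : Arc G) → a ∈ P) × ((v : Node G) → v ∈ nodes P)

  inDegree : Node G → ℕ
  inDegree v = length (filter (λ a → hd G a ≟ v) (allFin (nA G)))

  JoinFree : Arc G → Set
  JoinFree e = inDegree (hd G e) ≤ 1

  -- omnitig W = e_0 ... e_ℓ : for all 1 ≤ i ≤ j ≤ ℓ there is no non-empty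
  -- path from t(e_j) to h(e_{i-1}) whose first arc differs from e_j and
  -- whose last arc differs from e_{i-1}.  (Indices: a = i-1, b = j, a < b.)
  IsOmnitig : List (Arc G) → Set
  IsOmnitig W = IsWalk W ×
    ((a b : Fin (length W)) → toℕ a < toℕ b →
      ¬ (Σ (List (Arc G)) λ P → IsPath P ×
           StartsEnds P (tl G (lookup W b)) (hd G (lookup W a)) ×
           head P ≢ just (lookup W b) × last P ≢ just (lookup W a)))

mergedCount : (n : ℕ) → Fin n → Fin n → ℕ
mergedCount n u v with u ≟ v
... | yes _ = n
... | no  _ = pred n

-- map a node to its class after identifying v with u (v is removed)
mergeV : {n : ℕ} (u v : Fin n) → Fin n → Fin (mergedCount n u v)
mergeV {suc k} u v x with u ≟ v
... | yes _ = x
... | no u≢v with x ≟ v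
...   | yes _   = punchOut {i = v} {j = u} (u≢v ∘ sym)
...   | no x≢v  = punchOut {i = v} {j = x} (x≢v ∘ sym)

-- arcs of c_e(G) are the arcs of G other than e, reindexed into Fin (pred m)
arcIn : {m : ℕ} → Fin m → Fin (pred m) → Fin m
arcIn {suc k} e a = punchIn e a

arcOut : {m : ℕ} (e a : Fin m) → a ≢ e → Fin (pred m)
arcOut {suc k} e a a≢e = punchOut {i = e} {j = a} (a≢e ∘ sym)

contract : (G : Graph) → Arc G → Graph
contract G e = record
  { nV = mergedCount (nV G) (tl G e) (hd G e)
  ; nA = pred (nA G)
  ; tl = λ a → mergeV (tl G e) (hd G e) (tl G (arcIn e a))
  ; hd = λ a → mergeV (tl G e) (hd G e) (hd G (arcIn e a))
  }

contractWalk : (G : Graph) (e : Arc G) → List (Arc G) → List (Arc (contract G e))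
contractWalk G e []      = []
contractWalk G e (a ∷ W) with a ≟ e
... | yes _   = contractWalk G e W
... | no a≢e  = arcOut e a a≢e ∷ contractWalk G e W

module Submission where

-- Write e = u → v; join-freeness makes e the only arc entering v. An omnitig is a walk no two of
-- whose arcs are joined by a forbidden path, so everything reduces to comparing forbidden paths of G
-- and c_e(G). A forbidden path of G between arcs other than e contracts to one of c_e(G), after
-- cutting it at its last visit of u or v if it starts there; one starting with e contracts to a
-- forbidden path from any arc leaving v. Conversely a forbidden path of c_e(G) lifts to G by
-- re-inserting e in front of arcs leaving v: it becomes a forbidden path between the same arcs, or one
-- starting with e when it leaves u although the arc it starts from leaves v. No forbidden path ends in
-- e. Hence contracting an omnitig of G gives an omnitig, and re-inserting e into an omnitig of c_e(G)
-- gives an omnitig of G contracting back to it.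

open import Defs hiding (_∈_)
open import Data.Empty using (⊥; ⊥-elim)
open import Data.Fin as Fin using (Fin; toℕ; fromℕ<; _≟_)
open import Data.Fin.Properties
  using (toℕ-fromℕ<; punchInᵢ≢i; punchIn-injective; punchIn-punchOut; punchOut-punchIn;
         punchOut-injective; punchOut-cong)
open import Data.List using (List; []; _∷_; _++_; _∷ʳ_; length; lookup; map; head; last)
open import Data.List.Properties using (length-map)
open import Data.List.Membership.Propositional using (_∈_)
open import Data.List.Membership.Propositional.Properties using (∈-filter⁺; ∈-allFin; ∈-++⁺ʳ)
open import Data.List.Relation.Unary.Any using (here; there; any?)
open import Data.List.Relation.Unary.All as All using (All; []; _∷_)
import Data.List.Relation.Unary.All.Properties as All
open import Data.List.Relation.Unary.AllPairs as AllPairs using (AllPairs; []; _∷_)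
import Data.List.Relation.Unary.AllPairs.Properties as AllPairs
open import Data.List.Relation.Unary.Unique.Propositional using (Unique)
open import Data.Maybe using (Maybe; just; nothing)
open import Data.Maybe.Properties using (just-injective)
open import Data.Nat using (ℕ; zero; suc; pred; _<_; _≤_; z≤n; s≤s; _<?_)
open import Data.Nat.Properties using (≤-antisym; <-trans; <-irrefl; ≮⇒≥)
open import Data.Product using (Σ; _×_; _,_; proj₁; proj₂)
open import Data.Sum using (_⊎_; inj₁; inj₂)
open import Data.Unit using (⊤; tt)
open import Function using (_∘_)
open import Function.Bundles using (_⇔_; mk⇔; Equivalence)
open import Function.Properties.Equivalence using () renaming (trans to ⇔-trans)
open import Relation.Nullary using (¬_; yes; no; Dec; ¬?; _×-dec_)
open import Relation.Unary using (Decidable)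
open import Relation.Binary.PropositionalEquality

last⁺ : {A : Set} → A → List A → A
last⁺ x []       = x
last⁺ _ (y ∷ ys) = last⁺ y ys

last⁺-map : {A B : Set} (f : A → B) (x : A) (xs : List A) → last⁺ (f x) (map f xs) ≡ f (last⁺ x xs)
last⁺-map f x []       = refl
last⁺-map f x (y ∷ ys) = last⁺-map f y ys

AtEnds : ℕ → ℕ → ℕ → Set
AtEnds n i j = i ≡ 0 × j ≡ n

module _ {A : Set} where

  last-∷ : (x : A) (xs : List A) → last (x ∷ xs) ≡ just (last⁺ x xs)
  last-∷ x []       = refl
  last-∷ x (y ∷ ys) = last-∷ y ys

  last⁺-++ : (x : A) (pre : List A) {y : A} {ys : List A} → last⁺ x (pre ++ y ∷ ys) ≡ last⁺ y ys
  last⁺-++ x []        = refl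
  last⁺-++ x (z ∷ pre) = last⁺-++ z pre

  last-++-∷ : (pre : List A) {x : A} {xs : List A} → last (pre ++ x ∷ xs) ≡ just (last⁺ x xs)
  last-++-∷ [] {x} {xs} = last-∷ x xs
  last-++-∷ (z ∷ pre)   = trans (last-∷ z (pre ++ _)) (cong just (last⁺-++ z pre))

  ∈-length≤1 : {xs : List A} {x y : A} → length xs ≤ 1 → x ∈ xs → y ∈ xs → x ≡ y
  ∈-length≤1 {_ ∷ []}    _         (here x≡) (here y≡) = trans x≡ (sym y≡)
  ∈-length≤1 {_ ∷ _ ∷ _} (s≤s ())  _         _

  All⇒AllPairs : {P : A → Set} {R : A → A → Set} → (∀ {x y} → P x → P y → R x y) →
                 {xs : List A} → All P xs → AllPairs R xs
  All⇒AllPairs f []         = []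
  All⇒AllPairs f (px ∷ pxs) = All.map (f px) pxs ∷ All⇒AllPairs f pxs

  Unique-map-injective : {B : Set} {f : A → B} {xs : List A} {x y : A} →
                         Unique (map f xs) → x ∈ xs → y ∈ xs → f x ≡ f y → x ≡ y
  Unique-map-injective _         (here x≡) (here y≡) _ = trans x≡ (sym y≡)
  Unique-map-injective (fx∉ ∷ _) (here refl) (there y∈) fx≡fy =
    ⊥-elim (All.lookup (All.map⁻ fx∉) y∈ fx≡fy)
  Unique-map-injective (fy∉ ∷ _) (there x∈) (here refl) fx≡fy =
    ⊥-elim (All.lookup (All.map⁻ fy∉) x∈ (sym fx≡fy))
  Unique-map-injective (_ ∷ u)   (there x∈) (there y∈) fx≡fy = Unique-map-injective u x∈ y∈ fx≡fy

  record LastOccurrence (D : A → Set) (xs : List A) : Set where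
    constructor lastOccurrence
    field
      prefix     : List A
      pivot      : A
      suffix     : List A
      splits     : xs ≡ prefix ++ pivot ∷ suffix
      holds      : D pivot
      none-after : All (¬_ ∘ D) suffix

  lastOccurrence? : {D : A → Set} → Decidable D → (xs : List A) →
    All (¬_ ∘ D) xs ⊎ LastOccurrence D xs
  lastOccurrence? D? [] = inj₁ []
  lastOccurrence? D? (x ∷ xs) with lastOccurrence? D? xs
  ... | inj₂ (lastOccurrence pre y ys refl dy none) = inj₂ (lastOccurrence (x ∷ pre) y ys refl dy none)
  ... | inj₁ none with D? x
  ...   | yes dx  = inj₂ (lastOccurrence [] x xs refl dx none)
  ...   | no ¬dx  = inj₁ (¬dx ∷ none)

  -- Unlike Fin-indexed lookup, ℕ-indexed lookup can be transported along equations between lists.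
  _‼_ : List A → ℕ → Maybe A
  []       ‼ _     = nothing
  (x ∷ xs) ‼ zero  = just x
  (x ∷ xs) ‼ suc i = xs ‼ i

  ‼-lookup : (xs : List A) (i : Fin (length xs)) → xs ‼ toℕ i ≡ just (lookup xs i)
  ‼-lookup (x ∷ xs) Fin.zero    = refl
  ‼-lookup (x ∷ xs) (Fin.suc i) = ‼-lookup xs i

  ‼-length : (xs : List A) (i : ℕ) {x : A} → xs ‼ i ≡ just x → i < length xs
  ‼-length (x ∷ xs) zero    _  = s≤s z≤n
  ‼-length (x ∷ xs) (suc i) eq = s≤s (‼-length xs i eq)

  ‼-++ˡ : (xs ys : List A) (i : ℕ) → i < length xs → (xs ++ ys) ‼ i ≡ xs ‼ i
  ‼-++ˡ (x ∷ xs) ys zero    _         = refl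
  ‼-++ˡ (x ∷ xs) ys (suc i) (s≤s i<) = ‼-++ˡ xs ys i i<

  RepeatsOnlyAtᶠ : List A → (ℕ → ℕ → Set) → Set
  RepeatsOnlyAtᶠ xs P =
    (i j : Fin (length xs)) → toℕ i < toℕ j → lookup xs i ≡ lookup xs j → P (toℕ i) (toℕ j)

  RepeatsOnlyAt : List A → (ℕ → ℕ → Set) → Set
  RepeatsOnlyAt xs P = ∀ {i j x} → i < j → xs ‼ i ≡ just x → xs ‼ j ≡ just x → P i j

  repeatsOnlyAt⇔ᶠ : (xs : List A) (P : ℕ → ℕ → Set) → RepeatsOnlyAtᶠ xs P ⇔ RepeatsOnlyAt xs P
  repeatsOnlyAt⇔ᶠ xs P = mk⇔ to from
    where
      to : RepeatsOnlyAtᶠ xs P → RepeatsOnlyAt xs P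
      to rep {i} {j} i<j xsᵢ xsⱼ = subst₂ P (toℕ-fromℕ< i<len) (toℕ-fromℕ< j<len)
        (rep (fromℕ< i<len) (fromℕ< j<len)
             (subst₂ _<_ (sym (toℕ-fromℕ< i<len)) (sym (toℕ-fromℕ< j<len)) i<j)
             (just-injective (trans (at i<len xsᵢ) (sym (at j<len xsⱼ)))))
        where
          i<len : i < length xs
          i<len = ‼-length xs i xsᵢ
          j<len : j < length xs
          j<len = ‼-length xs j xsⱼ
          at : {k : ℕ} {x : A} (k< : k < length xs) → xs ‼ k ≡ just x →
            just (lookup xs (fromℕ< k<)) ≡ just x
          at {k} k< eq =
            trans (sym (‼-lookup xs (fromℕ< k<))) (trans (cong (xs ‼_) (toℕ-fromℕ< k<)) eq)
      from : RepeatsOnlyAt xs P → RepeatsOnlyAtᶠ xs P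
      from rep i j i<j eq = rep i<j (trans (‼-lookup xs i) (cong just eq)) (‼-lookup xs j)

  PairsByLookup : (A → A → Set) → List A → Set
  PairsByLookup R xs = (i j : Fin (length xs)) → toℕ i < toℕ j → R (lookup xs i) (lookup xs j)

  AllPairs⇔lookup : {R : A → A → Set} (xs : List A) → AllPairs R xs ⇔ PairsByLookup R xs
  AllPairs⇔lookup {R} xs = mk⇔ (to xs) (from xs)
    where
      All-lookup : ∀ {x} (ys : List A) → All (R x) ys → (j : Fin (length ys)) → R x (lookup ys j)
      All-lookup (y ∷ ys) (r ∷ _)  Fin.zero    = r
      All-lookup (y ∷ ys) (_ ∷ rs) (Fin.suc j) = All-lookup ys rs j
      lookup-All : ∀ {x} (ys : List A) → ((j : Fin (length ys)) → R x (lookup ys j)) → All (R x) ys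
      lookup-All []       _ = []
      lookup-All (y ∷ ys) r = r Fin.zero ∷ lookup-All ys (r ∘ Fin.suc)
      to : (xs : List A) → AllPairs R xs → PairsByLookup R xs
      to (x ∷ xs) (rx ∷ _)  Fin.zero    (Fin.suc j) _         = All-lookup xs rx j
      to (x ∷ xs) (_ ∷ rxs) (Fin.suc i) (Fin.suc j) (s≤s i<j) = to xs rxs i j i<j
      from : (xs : List A) → PairsByLookup R xs → AllPairs R xs
      from []       _ = []
      from (x ∷ xs) r = lookup-All xs (λ j → r Fin.zero (Fin.suc j) (s≤s z≤n))
                      ∷ from xs (λ i j i<j → r (Fin.suc i) (Fin.suc j) (s≤s i<j))

  Unique⇔repeatsOnlyAt : (xs : List A) → Unique xs ⇔ RepeatsOnlyAt xs (λ _ _ → ⊥)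
  Unique⇔repeatsOnlyAt xs = ⇔-trans (AllPairs⇔lookup xs) (repeatsOnlyAt⇔ᶠ xs (λ _ _ → ⊥))

  repeatsOnlyAtEnds⇔ : {x y : A} {ys zs : List A} {n : ℕ} →
    x ∷ ys ≡ zs ∷ʳ y → length ys ≡ n → length zs ≡ n →
    RepeatsOnlyAt (x ∷ ys) (AtEnds n) ⇔ (Unique ys × Unique zs)
  repeatsOnlyAtEnds⇔ {x} {y} {ys} {zs} {n} split |ys| |zs| = mk⇔ to from
    where
      agree : {k : ℕ} → k < n → (x ∷ ys) ‼ k ≡ zs ‼ k
      agree {k} k<n = trans (cong (_‼ k) split) (‼-++ˡ zs _ k (subst (k <_) (sym |zs|) k<n))
      to : RepeatsOnlyAt (x ∷ ys) (AtEnds n) → Unique ys × Unique zs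
      to rep = Equivalence.from (Unique⇔repeatsOnlyAt ys) no-repeat-in-ys
             , Equivalence.from (Unique⇔repeatsOnlyAt zs) no-repeat-in-zs
        where
          1+≢0 : {k : ℕ} → suc k ≢ 0
          1+≢0 ()
          no-repeat-in-ys : RepeatsOnlyAt ys (λ _ _ → ⊥)
          no-repeat-in-ys i<j ysᵢ ysⱼ = 1+≢0 (proj₁ (rep (s≤s i<j) ysᵢ ysⱼ))
          no-repeat-in-zs : RepeatsOnlyAt zs (λ _ _ → ⊥)
          no-repeat-in-zs {i} {j} i<j zsᵢ zsⱼ = <-irrefl (proj₂ (rep i<j
              (trans (agree (<-trans i<j j<n)) zsᵢ) (trans (agree j<n) zsⱼ))) j<n
            where
              j<n : j < n
              j<n = subst (j <_) |zs| (‼-length zs j zsⱼ)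
      from : Unique ys × Unique zs → RepeatsOnlyAt (x ∷ ys) (AtEnds n)
      from (ys! , zs!) {zero} {suc j} _ xs₀ xsⱼ with suc j <? n
      ... | yes 1+j<n = ⊥-elim (Equivalence.to (Unique⇔repeatsOnlyAt zs) zs! (s≤s z≤n)
                          (trans (sym (agree (<-trans (s≤s z≤n) 1+j<n))) xs₀)
                          (trans (sym (agree 1+j<n)) xsⱼ))
      ... | no 1+j≮n  =
        refl , ≤-antisym (subst (suc j ≤_) |ys| (‼-length ys j xsⱼ)) (≮⇒≥ 1+j≮n)
      from (ys! , _) {suc i} {suc j} (s≤s i<j) ysᵢ ysⱼ =
        ⊥-elim (Equivalence.to (Unique⇔repeatsOnlyAt ys) ys! i<j ysᵢ ysⱼ)

module _ (H : Graph) where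

  record SimplePath (P : List (Arc H)) : Set where
    field
      consecutive    : Consecutive H P
      distinct-heads : Unique (map (hd H) P)
      distinct-tails : Unique (map (tl H) P)
  open SimplePath public

  consecutive-∷⁻ : {x : Arc H} {P : List (Arc H)} → Consecutive H (x ∷ P) → Consecutive H P
  consecutive-∷⁻ {P = []}    _       = tt
  consecutive-∷⁻ {P = _ ∷ _} (_ , c) = c

  simplePath-++⁻ : (pre : List (Arc H)) {P : List (Arc H)} → SimplePath (pre ++ P) → SimplePath P
  simplePath-++⁻ []        sp = sp
  simplePath-++⁻ (x ∷ pre) sp = simplePath-++⁻ pre record
    { consecutive    = consecutive-∷⁻ (consecutive sp)
    ; distinct-heads = AllPairs.tail (distinct-heads sp)
    ; distinct-tails = AllPairs.tail (distinct-tails sp)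
    }

  nodes≡tails∷ʳ : (p : Arc H) (R : List (Arc H)) → Consecutive H (p ∷ R) →
    nodes H (p ∷ R) ≡ map (tl H) (p ∷ R) ∷ʳ hd H (last⁺ p R)
  nodes≡tails∷ʳ p []      _        = refl
  nodes≡tails∷ʳ p (q ∷ R) (p→q , c) =
    cong (tl H p ∷_) (trans (cong (_∷ map (hd H) (q ∷ R)) p→q) (nodes≡tails∷ʳ q R c))

  isPath⇔simplePath : (p : Arc H) (R : List (Arc H)) → IsPath H (p ∷ R) ⇔ SimplePath (p ∷ R)
  isPath⇔simplePath p R = mk⇔ to from
    where
      ends⇔ : Consecutive H (p ∷ R) →
        RepeatsOnlyAt (nodes H (p ∷ R)) (AtEnds (length (p ∷ R))) ⇔
        (Unique (map (hd H) (p ∷ R)) × Unique (map (tl H) (p ∷ R)))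
      ends⇔ c = repeatsOnlyAtEnds⇔ (nodes≡tails∷ʳ p R c)
                  (length-map (hd H) (p ∷ R)) (length-map (tl H) (p ∷ R))
      repeats⇔ : RepeatsOnlyAtᶠ (nodes H (p ∷ R)) (AtEnds (length (p ∷ R))) ⇔
                 RepeatsOnlyAt (nodes H (p ∷ R)) (AtEnds (length (p ∷ R)))
      repeats⇔ = repeatsOnlyAt⇔ᶠ (nodes H (p ∷ R)) (AtEnds (length (p ∷ R)))
      to : IsPath H (p ∷ R) → SimplePath (p ∷ R)
      to ((_ , c) , rep) with Equivalence.to (ends⇔ c) (Equivalence.to repeats⇔ rep)
      ... | heads! , tails! = record { consecutive = c ; distinct-heads = heads! ; distinct-tails = tails! }
      from : SimplePath (p ∷ R) → IsPath H (p ∷ R)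
      from sp = ((λ ()) , consecutive sp) , Equivalence.from repeats⇔
        (Equivalence.from (ends⇔ (consecutive sp)) (distinct-heads sp , distinct-tails sp))

  record ForbiddenPath (f g : Arc H) : Set where
    constructor forbiddenPath
    field
      first  : Arc H
      rest   : List (Arc H)
      simple : SimplePath (first ∷ rest)
      starts : tl H first ≡ tl H f
      first≢ : first ≢ f
      ends   : hd H (last⁺ first rest) ≡ hd H g
      last≢  : last⁺ first rest ≢ g

  ForbiddenPathAsList : Arc H → Arc H → Set
  ForbiddenPathAsList f g =
    Σ (List (Arc H)) λ P →
      IsPath H P × StartsEnds H P (tl H f) (hd H g) × head P ≢ just f × last P ≢ just g

  forbiddenPath⇔ : (f g : Arc H) → ForbiddenPathAsList f g ⇔ ForbiddenPath f g
  forbiddenPath⇔ f g = mk⇔ to from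
    where
      last-nodes : (p : Arc H) (R : List (Arc H)) → last (nodes H (p ∷ R)) ≡ just (hd H (last⁺ p R))
      last-nodes p R = trans (last-∷ (hd H p) (map (hd H) R)) (cong just (last⁺-map (hd H) p R))
      to : ForbiddenPathAsList f g → ForbiddenPath f g
      to ([] , ((P≢[] , _) , _) , _) = ⊥-elim (P≢[] refl)
      to (p ∷ R , path , (starts , ends) , first≢ , last≢) = forbiddenPath p R
        (Equivalence.to (isPath⇔simplePath p R) path)
        (just-injective starts)
        (first≢ ∘ cong just)
        (just-injective (trans (sym (last-nodes p R)) ends))
        (last≢ ∘ trans (last-∷ p R) ∘ cong just)
      from : ForbiddenPath f g → ForbiddenPathAsList f g
      from (forbiddenPath p R simple starts first≢ ends last≢) =
        p ∷ R , Equivalence.from (isPath⇔simplePath p R) simple ,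
        (cong just starts , trans (last-nodes p R) (cong just ends)) ,
        first≢ ∘ just-injective ,
        last≢ ∘ just-injective ∘ trans (sym (last-∷ p R))

  OmnitigPair : Arc H → Arc H → Set
  OmnitigPair a b = ¬ ForbiddenPath b a

  omnitig⇔ : (W : List (Arc H)) → IsOmnitig H W ⇔ (IsWalk H W × AllPairs OmnitigPair W)
  omnitig⇔ W = mk⇔
    (λ (walk , pairs) → walk , Equivalence.from (AllPairs⇔lookup W) λ i j i<j →
      pairs i j i<j ∘ Equivalence.from (forbiddenPath⇔ (lookup W j) (lookup W i)))
    (λ (walk , pairs) → walk , λ i j i<j →
      Equivalence.to (AllPairs⇔lookup W) pairs i j i<j
      ∘ Equivalence.to (forbiddenPath⇔ (lookup W j) (lookup W i)))

OneOf : {n : ℕ} → Fin n → Fin n → Fin n → Set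
OneOf u v x = x ≡ u ⊎ x ≡ v

oneOf? : {n : ℕ} (u v x : Fin n) → Dec (OneOf u v x)
oneOf? u v x with x ≟ u | x ≟ v
... | yes x≡u | _       = yes (inj₁ x≡u)
... | no _    | yes x≡v = yes (inj₂ x≡v)
... | no x≢u  | no x≢v  = no λ { (inj₁ x≡u) → x≢u x≡u ; (inj₂ x≡v) → x≢v x≡v }

mergeV-identifies : {n : ℕ} (u v : Fin n) → mergeV u v u ≡ mergeV u v v
mergeV-identifies {suc k} u v with u ≟ v
... | yes refl = refl
... | no u≢v with u ≟ v | v ≟ v
...   | yes u≡v | _      = ⊥-elim (u≢v u≡v)
...   | no _    | yes _  = refl
...   | no _    | no v≢v = ⊥-elim (v≢v refl)

mergeV-injective : {n : ℕ} (u v : Fin n) {x y : Fin n} → mergeV u v x ≡ mergeV u v y →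
  x ≡ y ⊎ (OneOf u v x × OneOf u v y)
mergeV-injective {suc k} u v {x} {y} eq with u ≟ v
... | yes _ = inj₁ eq
... | no u≢v with x ≟ v | y ≟ v
...   | yes x≡v | yes y≡v = inj₁ (trans x≡v (sym y≡v))
...   | yes x≡v | no y≢v  =
  inj₂ (inj₂ x≡v , inj₁ (sym (punchOut-injective (u≢v ∘ sym) (y≢v ∘ sym) eq)))
...   | no x≢v  | yes y≡v =
  inj₂ (inj₁ (punchOut-injective (x≢v ∘ sym) (u≢v ∘ sym) eq) , inj₂ y≡v)
...   | no x≢v  | no y≢v  = inj₁ (punchOut-injective (x≢v ∘ sym) (y≢v ∘ sym) eq)

arcIn-≢ : {m : ℕ} (e : Fin m) (a : Fin (pred m)) → arcIn e a ≢ e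
arcIn-≢ {suc k} e a = punchInᵢ≢i e a

arcIn-injective : {m : ℕ} (e : Fin m) {a b : Fin (pred m)} → arcIn e a ≡ arcIn e b → a ≡ b
arcIn-injective {suc k} e = punchIn-injective e _ _

arcIn-arcOut : {m : ℕ} (e a : Fin m) (a≢e : a ≢ e) → arcIn e (arcOut e a a≢e) ≡ a
arcIn-arcOut {suc k} e a a≢e = punchIn-punchOut (a≢e ∘ sym)

arcOut-irrelevant : {m : ℕ} (e a : Fin m) (p q : a ≢ e) → arcOut e a p ≡ arcOut e a q
arcOut-irrelevant {suc k} e a p q = punchOut-cong e refl

arcOut-arcIn : {m : ℕ} (e : Fin m) (a : Fin (pred m)) (ιa≢e : arcIn e a ≢ e) →
  arcOut e (arcIn e a) ιa≢e ≡ a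
arcOut-arcIn {suc k} e a _ = trans (punchOut-cong e refl) (punchOut-punchIn e)

module Contraction (G : Graph) (e : Arc G) (e-joinFree : JoinFree G e) where

  G′ : Graph
  G′ = contract G e

  u v : Node G
  u = tl G e
  v = hd G e

  merge : Node G → Node G′
  merge = mergeV u v

  ι : Arc G′ → Arc G
  ι = arcIn e

  cₑ : List (Arc G) → List (Arc G′)
  cₑ = contractWalk G e

  into-v⇒e : {x : Arc G} → hd G x ≡ v → x ≡ e
  into-v⇒e {x} x→v = ∈-length≤1 e-joinFree
    (∈-filter⁺ into-v? (∈-allFin x) x→v) (∈-filter⁺ into-v? (∈-allFin e) refl)
    where
      into-v? : (a : Arc G) → Dec (hd G a ≡ v)
      into-v? a = hd G a ≟ v

  hd-ι≢v : (a : Arc G′) → hd G (ι a) ≢ v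
  hd-ι≢v a = arcIn-≢ e a ∘ into-v⇒e

  merge-OneOf : {x y : Node G} → OneOf u v x → OneOf u v y → merge x ≡ merge y
  merge-OneOf (inj₁ refl) (inj₁ refl) = refl
  merge-OneOf (inj₁ refl) (inj₂ refl) = mergeV-identifies u v
  merge-OneOf (inj₂ refl) (inj₁ refl) = sym (mergeV-identifies u v)
  merge-OneOf (inj₂ refl) (inj₂ refl) = refl

  merge-injective-≢v : {x y : Node G} → x ≢ v → y ≢ v → merge x ≡ merge y → x ≡ y
  merge-injective-≢v x≢v y≢v eq with mergeV-injective u v eq
  ... | inj₁ x≡y                   = x≡y
  ... | inj₂ (inj₁ x≡u , inj₁ y≡u) = trans x≡u (sym y≡u)
  ... | inj₂ (inj₂ x≡v , _)        = ⊥-elim (x≢v x≡v)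
  ... | inj₂ (_ , inj₂ y≡v)        = ⊥-elim (y≢v y≡v)

  merge-injective-≢u : {x y : Node G} → x ≢ u → y ≢ u → merge x ≡ merge y → x ≡ y
  merge-injective-≢u x≢u y≢u eq with mergeV-injective u v eq
  ... | inj₁ x≡y                   = x≡y
  ... | inj₂ (inj₂ x≡v , inj₂ y≡v) = trans x≡v (sym y≡v)
  ... | inj₂ (inj₁ x≡u , _)        = ⊥-elim (x≢u x≡u)
  ... | inj₂ (_ , inj₁ y≡u)        = ⊥-elim (y≢u y≡u)

  merge-injective-∉ : {x y : Node G} → ¬ OneOf u v y → merge x ≡ merge y → x ≡ y
  merge-injective-∉ y∉ eq with mergeV-injective u v eq
  ... | inj₁ x≡y     = x≡y
  ... | inj₂ (_ , y∈) = ⊥-elim (y∉ y∈)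

  cₑ-∷ : {p : Arc G} (p≢e : p ≢ e) (R : List (Arc G)) → cₑ (p ∷ R) ≡ arcOut e p p≢e ∷ cₑ R
  cₑ-∷ {p} p≢e R with p ≟ e
  ... | yes p≡e = ⊥-elim (p≢e p≡e)
  ... | no p≢e′ = cong (_∷ cₑ R) (arcOut-irrelevant e p p≢e′ p≢e)

  ι-arcOut : {p : Arc G} (p≢e : p ≢ e) → ι (arcOut e p p≢e) ≡ p
  ι-arcOut {p} = arcIn-arcOut e p

  All-contract : {Q : Arc G → Set} {W : List (Arc G)} → All (λ y → y ≢ e → Q y) W →
    All (Q ∘ ι) (cₑ W)
  All-contract {W = []}    []        = []
  All-contract {Q} {W = y ∷ W} (qy ∷ qs) with y ≟ e
  ... | yes _   = All-contract qs
  ... | no y≢e  = subst Q (sym (ι-arcOut y≢e)) (qy y≢e) ∷ All-contract qs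

  AllPairs-contract : {S : Arc G → Arc G → Set} {W : List (Arc G)} → AllPairs S W →
    AllPairs (λ x y → S (ι x) (ι y)) (cₑ W)
  AllPairs-contract {W = []}    []        = []
  AllPairs-contract {S} {W = y ∷ W} (sy ∷ ss) with y ≟ e
  ... | yes _  = AllPairs-contract ss
  ... | no y≢e = All-contract (All.map (λ s _ → subst (λ w → S w _) (sym (ι-arcOut y≢e)) s) sy)
               ∷ AllPairs-contract ss

  Follows : Node G′ → List (Arc G) → Set
  Follows n []      = ⊤
  Follows n (y ∷ _) = n ≡ merge (tl G y)

  follows : {y : Arc G} {W : List (Arc G)} (y≢e : y ≢ e) → Consecutive G (y ∷ W) →
    Follows (hd G′ (arcOut e y y≢e)) W
  follows {W = []}    _   _         = tt
  follows {W = z ∷ W} y≢e (y→z , _) = cong merge (trans (cong (hd G) (ι-arcOut y≢e)) y→z)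

  consecutive-contract-after : (x : Arc G′) (W : List (Arc G)) → Follows (hd G′ x) W →
    Consecutive G W → Consecutive G′ (x ∷ cₑ W)
  consecutive-contract-after x []      _   _ = tt
  consecutive-contract-after x (y ∷ W) x→y c with y ≟ e
  ... | yes refl = consecutive-contract-after x W (after-e W c) (consecutive-∷⁻ G c)
    where
      after-e : (W : List (Arc G)) → Consecutive G (e ∷ W) → Follows (hd G′ x) W
      after-e []      _         = tt
      after-e (z ∷ W) (e→z , _) = trans x→y (trans (mergeV-identifies u v) (cong merge e→z))
  ... | no y≢e =
      trans x→y (cong (merge ∘ tl G) (sym (ι-arcOut y≢e)))
    , consecutive-contract-after (arcOut e y y≢e) W (follows y≢e c) (consecutive-∷⁻ G c)

  consecutive-contract : (W : List (Arc G)) → Consecutive G W → Consecutive G′ (cₑ W)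
  consecutive-contract []      _ = tt
  consecutive-contract (y ∷ W) c with y ≟ e
  ... | yes _  = consecutive-contract W (consecutive-∷⁻ G c)
  ... | no y≢e = consecutive-contract-after (arcOut e y y≢e) W (follows y≢e c) (consecutive-∷⁻ G c)

  ι-last⁺-contract : (x : Arc G) (x′ : Arc G′) → ι x′ ≡ x → (R : List (Arc G)) →
    last⁺ x R ≢ e → ι (last⁺ x′ (cₑ R)) ≡ last⁺ x R
  ι-last⁺-contract x x′ ιx′≡x []      _ = ιx′≡x
  ι-last⁺-contract x x′ ιx′≡x (y ∷ R) last≢e with y ≟ e
  ι-last⁺-contract x x′ ιx′≡x (y ∷ [])    last≢e | yes y≡e = ⊥-elim (last≢e y≡e)
  ι-last⁺-contract x x′ ιx′≡x (y ∷ z ∷ R) last≢e | yes _   =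
    ι-last⁺-contract x x′ ιx′≡x (z ∷ R) last≢e
  ... | no y≢e = ι-last⁺-contract y (arcOut e y y≢e) (ι-arcOut y≢e) R last≢e

  MergeSafe : Arc G′ → Arc G′ → Set
  MergeSafe x y = tl G′ x ≡ tl G′ y → tl G (ι x) ≡ tl G (ι y)

  simplePath-contract : {P : List (Arc G)} → SimplePath G P → AllPairs MergeSafe (cₑ P) →
    SimplePath G′ (cₑ P)
  simplePath-contract {P} sp safe = record
    { consecutive    = consecutive-contract P (consecutive sp)
    ; distinct-heads = AllPairs.map⁺ (AllPairs.map
                         (λ {x} {y} ne eq → ne (merge-injective-≢v (hd-ι≢v x) (hd-ι≢v y) eq))
                         (AllPairs-contract (AllPairs.map⁻ (distinct-heads sp))))
    ; distinct-tails = AllPairs.map⁺ (AllPairs.zipWith (λ (ne , safe) eq → ne (safe eq))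
                         (AllPairs-contract (AllPairs.map⁻ (distinct-tails sp)) , safe))
    }

  mergeSafe-≢u : {P : List (Arc G)} → All (λ y → y ≢ e → tl G y ≢ u) P →
    AllPairs MergeSafe (cₑ P)
  mergeSafe-≢u ≢u = All⇒AllPairs merge-injective-≢u (All-contract ≢u)

  mergeSafe-≢v : {P : List (Arc G)} → All (λ y → tl G y ≢ v) P → AllPairs MergeSafe (cₑ P)
  mergeSafe-≢v ≢v = All⇒AllPairs merge-injective-≢v (All-contract (All.map (λ ≢v _ → ≢v) ≢v))

  mergeSafe-∉ : {x : Arc G} (x≢e : x ≢ e) {S : List (Arc G)} → All (λ y → ¬ OneOf u v (tl G y)) S →
    AllPairs MergeSafe (cₑ (x ∷ S))
  mergeSafe-∉ x≢e {S} ∉ rewrite cₑ-∷ x≢e S =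
    All.map merge-injective-∉ ∉′ ∷ All⇒AllPairs (λ _ → merge-injective-∉) ∉′
    where
      ∉′ : All (λ y → ¬ OneOf u v (tl G (ι y))) (cₑ S)
      ∉′ = All-contract (All.map (λ ∉ _ → ∉) ∉)

  tails≢v : {x : Arc G} {R : List (Arc G)} → Consecutive G (x ∷ R) → All (_≢ e) (x ∷ R) →
    All (λ y → tl G y ≢ v) R
  tails≢v {R = []}    _         _          = []
  tails≢v {R = y ∷ R} (x→y , c) (x≢e ∷ ≢e) = (x≢e ∘ into-v⇒e ∘ trans x→y) ∷ tails≢v c ≢e

  -- Merging u and v can only identify two tails of a simple path if one of them is v; that arc
  -- is not the first, so it is entered by e, and then no other arc leaves u.
  mergeSafe-path : {p : Arc G} {R : List (Arc G)} → SimplePath G (p ∷ R) → p ≢ e → tl G p ≢ v →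
    AllPairs MergeSafe (cₑ (p ∷ R))
  mergeSafe-path {p} {R} sp p≢e p↛v with any? (e ≟_) R
  ... | yes e∈R = mergeSafe-≢u (All.tabulate λ y∈ y≢e tl≡u →
                    y≢e (Unique-map-injective (distinct-tails sp) y∈ (there e∈R) tl≡u))
  ... | no e∉R  = mergeSafe-≢v (p↛v ∷ tails≢v (consecutive sp)
                    (p≢e ∷ All.tabulate λ y∈ y≡e → e∉R (subst (_∈ R) y≡e y∈)))

  ¬forbiddenPath-into-e : {f : Arc G} → ¬ ForbiddenPath G f e
  ¬forbiddenPath-into-e fp = ForbiddenPath.last≢ fp (into-v⇒e (ForbiddenPath.ends fp))

  contractedForbiddenPath : {a b : Arc G′} {p : Arc G} {R : List (Arc G)} →
    SimplePath G (p ∷ R) → (p≢e : p ≢ e) → AllPairs MergeSafe (cₑ (p ∷ R)) →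
    merge (tl G p) ≡ tl G′ b → p ≢ ι b →
    hd G (last⁺ p R) ≡ hd G (ι a) → last⁺ p R ≢ ι a → ForbiddenPath G′ b a
  contractedForbiddenPath {a} {b} {p} {R} sp p≢e safe starts p≢ιb ends last≢ =
    forbiddenPath p′ (cₑ R)
      (subst (SimplePath G′) (cₑ-∷ p≢e R) (simplePath-contract sp safe))
      (trans (cong (merge ∘ tl G) (ι-arcOut p≢e)) starts)
      (λ p′≡b → p≢ιb (trans (sym (ι-arcOut p≢e)) (cong ι p′≡b)))
      (cong merge (trans (cong (hd G) ι-last) ends))
      (λ last≡a → last≢ (trans (sym ι-last) (cong ι last≡a)))
    where
      p′ : Arc G′
      p′ = arcOut e p p≢e
      ι-last : ι (last⁺ p′ (cₑ R)) ≡ last⁺ p R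
      ι-last = ι-last⁺-contract p p′ (ι-arcOut p≢e) R
        (λ last≡e → hd-ι≢v a (trans (sym ends) (cong (hd G) last≡e)))

  first≢e : {x : Arc G} {S : List (Arc G)} → Consecutive G (x ∷ S) →
    All (λ y → ¬ OneOf u v (tl G y)) S → last⁺ x S ≢ e → x ≢ e
  first≢e {S = []}    _         _        last≢e = last≢e
  first≢e {S = y ∷ _} (x→y , _) (y∉ ∷ _) _ x≡e  = y∉ (inj₂ (trans (sym x→y) (cong (hd G) x≡e)))

  -- A path leaving the merged node is shortened to its part after the last visit of u or v.
  forbiddenPath-contract : {a b : Arc G′} → ForbiddenPath G (ι b) (ι a) → ForbiddenPath G′ b a
  forbiddenPath-contract {a} {b} (forbiddenPath p R sp starts p≢ιb ends last≢) with oneOf? u v (tl G p)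
  ... | no p∉ =
    contractedForbiddenPath sp p≢e (mergeSafe-path sp p≢e (p∉ ∘ inj₂)) (cong merge starts) p≢ιb ends last≢
    where
      p≢e : p ≢ e
      p≢e p≡e = p∉ (inj₁ (cong (tl G) p≡e))
  ... | yes p∈ with lastOccurrence? (oneOf? u v ∘ tl G) (p ∷ R)
  ...   | inj₁ (p∉ ∷ _) = ⊥-elim (p∉ p∈)
  ...   | inj₂ (lastOccurrence pre x S split x∈ S∉) =
    contractedForbiddenPath sp′ x≢e (mergeSafe-∉ x≢e S∉) (merge-OneOf x∈ (subst (OneOf u v) starts p∈))
      x≢ιb (trans (cong (hd G) last-eq) ends) (last≢ ∘ trans (sym last-eq))
    where
      sp′ : SimplePath G (x ∷ S)
      sp′ = simplePath-++⁻ G pre (subst (SimplePath G) split sp)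
      last-eq : last⁺ x S ≡ last⁺ p R
      last-eq = just-injective (trans (sym (last-++-∷ pre)) (trans (cong last (sym split)) (last-∷ p R)))
      x≢e : x ≢ e
      x≢e = first≢e (consecutive sp′) S∉ λ last≡e →
        hd-ι≢v a (trans (sym ends) (cong (hd G) (trans (sym last-eq) last≡e)))
      x∈P : x ∈ p ∷ R
      x∈P = subst (x ∈_) (sym split) (∈-++⁺ʳ pre (here refl))
      x≢ιb : x ≢ ι b
      x≢ιb x≡ιb = p≢ιb (trans (sym (Unique-map-injective (distinct-tails sp) x∈P (here refl)
                    (trans (cong (tl G) x≡ιb) (sym starts)))) x≡ιb)

  forbiddenPath-from-e-contract : {a b : Arc G′} → u ≢ v → tl G (ι b) ≡ v → ForbiddenPath G e (ι a) →
    ForbiddenPath G′ b a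
  forbiddenPath-from-e-contract u≢v b↤v (forbiddenPath p R sp p↤u p≢e ends last≢) =
    contractedForbiddenPath sp p≢e (mergeSafe-path sp p≢e (u≢v ∘ trans (sym p↤u)))
      (trans (cong merge p↤u) (trans (mergeV-identifies u v) (cong merge (sym b↤v))))
      (λ p≡ιb → u≢v (trans (sym p↤u) (trans (cong (tl G) p≡ιb) b↤v)))
      ends last≢

  -- The arcs of c_e(G) that must be preceded by e when lifted back to G; when e is a loop there are none.
  NeedsE : Arc G′ → Set
  NeedsE y = tl G (ι y) ≡ v × u ≢ v

  needsE? : (y : Arc G′) → Dec (NeedsE y)
  needsE? y = (tl G (ι y) ≟ v) ×-dec ¬? (u ≟ v)

  expand : List (Arc G′) → List (Arc G)
  expand []      = []
  expand (y ∷ R) with needsE? y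
  ... | yes _ = e ∷ ι y ∷ expand R
  ... | no _  = ι y ∷ expand R

  expand-NeedsE : {y : Arc G′} (R : List (Arc G′)) → NeedsE y → expand (y ∷ R) ≡ e ∷ ι y ∷ expand R
  expand-NeedsE {y} R ny with needsE? y
  ... | yes _  = refl
  ... | no ¬ny = ⊥-elim (¬ny ny)

  expand≢[] : {W′ : List (Arc G′)} → W′ ≢ [] → expand W′ ≢ []
  expand≢[] {[]}    W′≢[] = ⊥-elim (W′≢[] refl)
  expand≢[] {y ∷ R} _ with needsE? y
  ... | yes _ = λ ()
  ... | no _  = λ ()

  cₑ-e : (W : List (Arc G)) → cₑ (e ∷ W) ≡ cₑ W
  cₑ-e W with e ≟ e
  ... | yes _  = refl
  ... | no e≢e = ⊥-elim (e≢e refl)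

  cₑ-ι : (y : Arc G′) (W : List (Arc G)) → cₑ (ι y ∷ W) ≡ y ∷ cₑ W
  cₑ-ι y W = trans (cₑ-∷ (arcIn-≢ e y) W) (cong (_∷ cₑ W) (arcOut-arcIn e y (arcIn-≢ e y)))

  contract-expand : (W′ : List (Arc G′)) → cₑ (expand W′) ≡ W′
  contract-expand []      = refl
  contract-expand (y ∷ R) with needsE? y
  ... | yes _ =
    trans (cₑ-e (ι y ∷ expand R)) (trans (cₑ-ι y (expand R)) (cong (y ∷_) (contract-expand R)))
  ... | no _  = trans (cₑ-ι y (expand R)) (cong (y ∷_) (contract-expand R))

  last⁺-expand : (x : Arc G′) (R : List (Arc G′)) → last⁺ (ι x) (expand R) ≡ ι (last⁺ x R)
  last⁺-expand x []      = refl
  last⁺-expand x (y ∷ R) with needsE? y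
  ... | yes _ = last⁺-expand y R
  ... | no _  = last⁺-expand y R

  hd≡u-before-NeedsE : {x y : Arc G′} → hd G′ x ≡ tl G′ y → NeedsE y → hd G (ι x) ≡ u
  hd≡u-before-NeedsE {x} {y} x→y (y↤v , _) with mergeV-injective u v x→y
  ... | inj₁ x→y′           = ⊥-elim (hd-ι≢v x (trans x→y′ y↤v))
  ... | inj₂ (inj₁ x→u , _) = x→u
  ... | inj₂ (inj₂ x→v , _) = ⊥-elim (hd-ι≢v x x→v)

  hd≡tl-unless-NeedsE : {x y : Arc G′} → hd G′ x ≡ tl G′ y → ¬ NeedsE y →
    hd G (ι x) ≡ tl G (ι y)
  hd≡tl-unless-NeedsE {x} {y} x→y ¬ny with mergeV-injective u v x→y
  ... | inj₁ x→y′                   = x→y′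
  ... | inj₂ (inj₂ x→v , _)         = ⊥-elim (hd-ι≢v x x→v)
  ... | inj₂ (inj₁ x→u , inj₁ y↤u) = trans x→u (sym y↤u)
  ... | inj₂ (inj₁ x→u , inj₂ y↤v) = by-loop (u ≟ v)
    where
      by-loop : Dec (u ≡ v) → hd G (ι x) ≡ tl G (ι y)
      by-loop (yes u≡v) = trans x→u (trans u≡v (sym y↤v))
      by-loop (no u≢v)  = ⊥-elim (¬ny (y↤v , u≢v))

  consecutive-expand-after : (x : Arc G′) (R : List (Arc G′)) → Consecutive G′ (x ∷ R) →
    Consecutive G (ι x ∷ expand R)
  consecutive-expand-after x []      _         = tt
  consecutive-expand-after x (y ∷ R) (x→y , c) with needsE? y
  ... | yes ny  = hd≡u-before-NeedsE x→y ny , sym (proj₁ ny) , consecutive-expand-after y R c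
  ... | no ¬ny  = hd≡tl-unless-NeedsE x→y ¬ny , consecutive-expand-after y R c

  consecutive-expand : (W′ : List (Arc G′)) → Consecutive G′ W′ → Consecutive G (expand W′)
  consecutive-expand []      _ = tt
  consecutive-expand (y ∷ R) c with needsE? y
  ... | yes ny = sym (proj₁ ny) , consecutive-expand-after y R c
  ... | no _   = consecutive-expand-after y R c

  All-expand : {Q : Arc G → Set} {R : List (Arc G′)} → All (λ y → Q (ι y) × (NeedsE y → Q e)) R →
    All Q (expand R)
  All-expand {R = []}    []               = []
  All-expand {R = y ∷ R} ((qy , qe) ∷ qs) with needsE? y
  ... | yes ny = qe ny ∷ qy ∷ All-expand qs
  ... | no _   = qy ∷ All-expand qs

  record ExpandedPair (S : Arc G → Arc G → Set) (y z : Arc G′) : Set where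
    field
      arcs  : S (ι y) (ι z)
      arc-e : NeedsE z → S (ι y) e
      e-arc : NeedsE y → S e (ι z)
      e-e   : NeedsE y → NeedsE z → S e e

  AllPairs-expand : {S : Arc G → Arc G → Set} {R : List (Arc G′)} → AllPairs (ExpandedPair S) R →
    All (λ y → NeedsE y → S e (ι y)) R → AllPairs S (expand R)
  AllPairs-expand {R = []}    []        []        = []
  AllPairs-expand {S} {R = y ∷ R} (py ∷ ps) (ey ∷ es) with needsE? y
  ... | yes ny = (ey ny ∷ All-expand (All.map (λ p → ExpandedPair.e-arc p ny , ExpandedPair.e-e p ny) py))
               ∷ from-y ∷ AllPairs-expand ps es
    where
      from-y : All (S (ι y)) (expand R)
      from-y = All-expand (All.map (λ p → ExpandedPair.arcs p , ExpandedPair.arc-e p) py)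
  ... | no _   = All-expand (All.map (λ p → ExpandedPair.arcs p , ExpandedPair.arc-e p) py)
               ∷ AllPairs-expand ps es

  simplePath-expand : {W′ : List (Arc G′)} → SimplePath G′ W′ → SimplePath G (expand W′)
  simplePath-expand {W′} sp = record
    { consecutive    = consecutive-expand W′ (consecutive sp)
    ; distinct-heads = AllPairs.map⁺ (AllPairs-expand (AllPairs.map heads pairs′)
                         (All.universal (λ y _ → hd-ι≢v y ∘ sym) W′))
    ; distinct-tails = AllPairs.map⁺ (AllPairs-expand (AllPairs.map tails pairs′)
                         (All.universal (λ y (y↤v , u≢v) u≡ → u≢v (trans u≡ y↤v)) W′))
    }
    where
      pairs′ : AllPairs (λ y z → hd G′ y ≢ hd G′ z × tl G′ y ≢ tl G′ z) W′
      pairs′ = AllPairs.zip (AllPairs.map⁻ (distinct-heads sp) , AllPairs.map⁻ (distinct-tails sp))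
      both-need-e : {y z : Arc G′} → tl G′ y ≢ tl G′ z → NeedsE y → NeedsE z → ⊥
      both-need-e y≢z (y↤v , _) (z↤v , _) = y≢z (cong merge (trans y↤v (sym z↤v)))
      heads : {y z : Arc G′} → hd G′ y ≢ hd G′ z × tl G′ y ≢ tl G′ z →
        ExpandedPair (λ x w → hd G x ≢ hd G w) y z
      heads {y} {z} (hd≢ , tl≢) = record
        { arcs  = hd≢ ∘ cong merge
        ; arc-e = λ _ → hd-ι≢v y
        ; e-arc = λ _ → hd-ι≢v z ∘ sym
        ; e-e   = λ ny nz _ → both-need-e tl≢ ny nz
        }
      tails : {y z : Arc G′} → hd G′ y ≢ hd G′ z × tl G′ y ≢ tl G′ z →
        ExpandedPair (λ x w → tl G x ≢ tl G w) y z
      tails {y} {z} (_ , tl≢) = record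
        { arcs  = tl≢ ∘ cong merge
        ; arc-e = λ (z↤v , _) y↤u →
            tl≢ (trans (cong merge y↤u) (trans (mergeV-identifies u v) (cong merge (sym z↤v))))
        ; e-arc = λ (y↤v , _) u↦z →
            tl≢ (trans (cong merge y↤v) (trans (sym (mergeV-identifies u v)) (cong merge u↦z)))
        ; e-e   = λ ny nz _ → both-need-e tl≢ ny nz
        }

  simplePath-expand-∷ : {p : Arc G′} {R : List (Arc G′)} → SimplePath G′ (p ∷ R) →
    SimplePath G (ι p ∷ expand R)
  simplePath-expand-∷ {p} {R} sp with needsE? p | simplePath-expand sp
  ... | yes _ | sp′ = simplePath-++⁻ G (e ∷ []) sp′
  ... | no _  | sp′ = sp′

  forbiddenPath-lift : {a b : Arc G′} → ForbiddenPath G′ b a →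
    ForbiddenPath G (ι b) (ι a) ⊎ (tl G (ι b) ≡ v × ForbiddenPath G e (ι a))
  forbiddenPath-lift {a} {b} (forbiddenPath p R sp starts p≢b ends last≢) =
    by-start (tl G (ι p) ≟ tl G (ι b)) (mergeV-injective u v starts)
    where
      ends′ : hd G (last⁺ (ι p) (expand R)) ≡ hd G (ι a)
      ends′ = trans (cong (hd G) (last⁺-expand p R)) (merge-injective-≢v (hd-ι≢v _) (hd-ι≢v a) ends)
      last≢′ : last⁺ (ι p) (expand R) ≢ ι a
      last≢′ eq = last≢ (arcIn-injective e (trans (sym (last⁺-expand p R)) eq))
      by-start : Dec (tl G (ι p) ≡ tl G (ι b)) →
        tl G (ι p) ≡ tl G (ι b) ⊎ (OneOf u v (tl G (ι p)) × OneOf u v (tl G (ι b))) →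
        ForbiddenPath G (ι b) (ι a) ⊎ (tl G (ι b) ≡ v × ForbiddenPath G e (ι a))
      by-start (yes p↤b) _ =
        inj₁ (forbiddenPath (ι p) (expand R) (simplePath-expand-∷ sp) p↤b (p≢b ∘ arcIn-injective e) ends′ last≢′)
      by-start (no ¬p↤b) (inj₁ p↤b)                   = ⊥-elim (¬p↤b p↤b)
      by-start (no ¬p↤b) (inj₂ (inj₁ p↤u , inj₁ b↤u)) = ⊥-elim (¬p↤b (trans p↤u (sym b↤u)))
      by-start (no ¬p↤b) (inj₂ (inj₂ p↤v , inj₂ b↤v)) = ⊥-elim (¬p↤b (trans p↤v (sym b↤v)))
      by-start (no _)    (inj₂ (inj₁ p↤u , inj₂ b↤v)) =
        inj₂ (b↤v , forbiddenPath (ι p) (expand R) (simplePath-expand-∷ sp) p↤u (arcIn-≢ e p) ends′ last≢′)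
      by-start (no ¬p↤b) (inj₂ (inj₂ p↤v , inj₁ b↤u)) =
        inj₁ (forbiddenPath e (ι p ∷ expand R)
          (subst (SimplePath G) (expand-NeedsE R (p↤v , u≢v)) (simplePath-expand sp))
          (sym b↤u) (arcIn-≢ e b ∘ sym) ends′ last≢′)
        where
          u≢v : u ≢ v
          u≢v u≡v = ¬p↤b (trans p↤v (trans (sym u≡v) (sym b↤u)))

  e-between : {a : Arc G} {R : List (Arc G)} → Consecutive G (a ∷ R) → a ≢ e →
    {z : Arc G} → z ∈ R → tl G z ≡ v → e ∈ R
  e-between {a} {y ∷ R} (a→y , _) a≢e (here refl) z↤v = ⊥-elim (a≢e (into-v⇒e (trans a→y z↤v)))
  e-between {a} {y ∷ R} (_ , c)   a≢e (there z∈R) z↤v with y ≟ e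
  ... | yes y≡e = here (sym y≡e)
  ... | no y≢e  = there (e-between c y≢e z∈R z↤v)

  omnitigPairs-contract : (W : List (Arc G)) → Consecutive G W → AllPairs (OmnitigPair G) W →
    AllPairs (OmnitigPair G′) (cₑ W)
  omnitigPairs-contract []      _ []        = []
  omnitigPairs-contract (a ∷ R) c (pa ∷ ps) with a ≟ e
  ... | yes _  = omnitigPairs-contract R (consecutive-∷⁻ G c) ps
  ... | no a≢e =
      All.map no-lift (All-contract (All.tabulate λ z∈R _ →
        All.lookup pa z∈R , All.lookup pa ∘ e-between c a≢e z∈R))
    ∷ omnitigPairs-contract R (consecutive-∷⁻ G c) ps
    where
      no-lift : {z : Arc G′} → ¬ ForbiddenPath G (ι z) a × (tl G (ι z) ≡ v → ¬ ForbiddenPath G e a) →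
        OmnitigPair G′ (arcOut e a a≢e) z
      no-lift (¬fp , ¬fp-e) fp′ with forbiddenPath-lift fp′
      ... | inj₁ fp         = ¬fp (subst (ForbiddenPath G _) (ι-arcOut a≢e) fp)
      ... | inj₂ (z↤v , fp) = ¬fp-e z↤v (subst (ForbiddenPath G e) (ι-arcOut a≢e) fp)

  omnitigPairs-expand : {W′ : List (Arc G′)} → AllPairs (OmnitigPair G′) W′ →
    AllPairs (OmnitigPair G) (expand W′)
  omnitigPairs-expand {W′} pairs =
    AllPairs-expand (AllPairs.map expanded pairs) (All.universal (λ _ _ → ¬forbiddenPath-into-e) W′)
    where
      expanded : {y z : Arc G′} → OmnitigPair G′ y z → ExpandedPair (OmnitigPair G) y z
      expanded ok = record
        { arcs  = ok ∘ forbiddenPath-contract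
        ; arc-e = λ (z↤v , u≢v) → ok ∘ forbiddenPath-from-e-contract u≢v z↤v
        ; e-arc = λ _ → ¬forbiddenPath-into-e
        ; e-e   = λ _ _ → ¬forbiddenPath-into-e
        }

  omnitig-contract : {W : List (Arc G)} → IsOmnitig G W → IsWalk G′ (cₑ W) → IsOmnitig G′ (cₑ W)
  omnitig-contract {W} om walk′ with Equivalence.to (omnitig⇔ G W) om
  ... | (_ , c) , pairs = Equivalence.from (omnitig⇔ G′ (cₑ W)) (walk′ , omnitigPairs-contract W c pairs)

  omnitig-expand : {W′ : List (Arc G′)} → IsOmnitig G′ W′ → IsOmnitig G (expand W′)
  omnitig-expand {W′} om with Equivalence.to (omnitig⇔ G′ W′) om
  ... | (W′≢[] , c) , pairs = Equivalence.from (omnitig⇔ G (expand W′))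
    ((expand≢[] W′≢[] , consecutive-expand W′ c) , omnitigPairs-expand pairs)

lemma33 : (G : Graph) → StronglyConnected G → ¬ IsClosedPathGraph G →
    (e : Arc G) → JoinFree G e →
    (W′ : List (Arc (contract G e))) → IsWalk (contract G e) W′ →
    (IsOmnitig (contract G e) W′ ⇔
      Σ (List (Arc G)) (λ W → IsOmnitig G W × contractWalk G e W ≡ W′))
lemma33 G _ _ e e-joinFree W′ walk′ = mk⇔
  (λ om → expand W′ , omnitig-expand om , contract-expand W′)
  (λ { (W , om , refl) → omnitig-contract om walk′ })
  where
    open Contraction G e e-joinFree
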